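{- Let $W\subset\mathbb{R}/\mathbb{Z}$ with $|W|\ge 16$. Then there exists $W'\subset W$ with $|W'|=4$ such that $(W'+\tfrac{i}{k})\cap W'=\varnothing$ for all $k\in\{2,3,4,5\}$ and all $i\in\{1,\dots,k-1\}$.
   Context: For a set $W$ and real $\alpha$, $W+\alpha=\{w+\alpha:w\in W\}$, computed modulo $1$. -}

module Defs where

open import Level using (0ℓ)
open import Data.Nat as ℕ using (ℕ; zero; suc)
open import Data.Integer as ℤ using (ℤ; +_; -[1+_])
open import Data.Product using (Σ; ∃; _×_)
open import Data.Sum using (_⊎_)
open import Data.Fin using (Fin)
open import Relation.Binary.PropositionalEquality using (_≡_; _≢_)
open import Relation.Nullary using (¬_)
open import Algebra.Structures using (IsCommutativeRing)
open import Relation.Binary.Structures using (IsStrictTotalOrder)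

record RealNumbers : Set₁ where
  infixl 6 _+_
  infixl 7 _*_
  infix 4 _<_ _≤_
  field
    ℝ   : Set
    _+_ : ℝ → ℝ → ℝ
    _*_ : ℝ → ℝ → ℝ
    -_  : ℝ → ℝ
    0r  : ℝ
    1r  : ℝ
    _⁻¹ : ℝ → ℝ
    _<_ : ℝ → ℝ → Set
    isCommutativeRing : IsCommutativeRing _≡_ _+_ _*_ -_ 0r 1r
    0≢1     : 0r ≢ 1r
    ⁻¹-inverse : ∀ x → x ≢ 0r → x * (x ⁻¹) ≡ 1r
    <-isStrictTotalOrder : IsStrictTotalOrder _≡_ _<_
    +-mono-< : ∀ {x y} z → x < y → x + z < y + z
    *-pos    : ∀ {x y} → 0r < x → 0r < y → 0r < x * y

  _≤_ : ℝ → ℝ → Set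
  x ≤ y = x < y ⊎ x ≡ y

  field
    complete : (S : ℝ → Set) → ∃ S → (∃ λ b → ∀ x → S x → x ≤ b) →
               ∃ λ s → (∀ x → S x → x ≤ s) × (∀ b → (∀ x → S x → x ≤ b) → s ≤ b)

  _-_ : ℝ → ℝ → ℝ
  x - y = x + (- y)

  fromℕ : ℕ → ℝ
  fromℕ zero    = 0r
  fromℕ (suc n) = 1r + fromℕ n

  fromℤ : ℤ → ℝ
  fromℤ (+ n)     = fromℕ n
  fromℤ -[1+ n ]  = - fromℕ (suc n)

  infix 4 _≈₁_
  _≈₁_ : ℝ → ℝ → Set
  x ≈₁ y = ∃ λ (z : ℤ) → x - y ≡ fromℤ z

  frac : ℕ → ℕ → ℝ
  frac i k = fromℕ i * (fromℕ k) ⁻¹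

  -- a subset of ℝ/ℤ, represented by a predicate on ℝ invariant mod 1
  RespectsMod1 : (ℝ → Set) → Set
  RespectsMod1 W = ∀ x y → x ≈₁ y → W x → W y

  HasAtLeast : ℕ → (ℝ → Set) → Set
  HasAtLeast n W = Σ (Fin n → ℝ) λ f → (∀ i → W (f i)) × (∀ i j → f i ≈₁ f j → i ≡ j)

module _ (R : RealNumbers) where
  open RealNumbers R hiding (_≤_; _<_)

  FourPointsAvoiding : (ℝ → Set) → Set
  FourPointsAvoiding W =
    Σ (Fin 4 → ℝ) λ w →
      (∀ a → W (w a)) × (∀ a b → w a ≈₁ w b → a ≡ b) ×
      (∀ (k i : ℕ) → 2 ℕ.≤ k → k ℕ.≤ 5 → 1 ℕ.≤ i → i ℕ.< k →
        ∀ a b → ¬ (w a + frac i k ≈₁ w b))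

  Theorem9 : Set₁
  Theorem9 = (W : ℝ → Set) → RespectsMod1 W → HasAtLeast 16 W → FourPointsAvoiding W

-- Every i/k with 2 ≤ k ≤ 5 is a multiple of 1/60. Partition ℝ/ℤ into cosets of (1/60)ℤ/ℤ,
-- choose a representative in each coset (by excluded middle, among the given points), and give
-- every point its position r ∈ ℤ/60 relative to that representative. Adding i/k moves a point
-- inside its coset by d = 60i/k ∈ {12, 15, 20, 24, 30, 36, 40, 45, 48}, and the 5-colouring
-- r ↦ (r mod 5 + r mod 4 + 2 (r mod 3)) mod 5 changes under each such shift: by the Chinese
-- remainder theorem the shift alters exactly the components whose modulus does not divide d,
-- and each altered component moves the sum by a nonzero amount modulo 5. Among 16 points four
-- share a colour, and no two of them differ by any i/k.
module Submission where

open import Defs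
open import Data.Nat using (ℕ; zero; suc)
open import Level using (0ℓ)
open import Axiom.ExcludedMiddle using (ExcludedMiddle)
open import Data.Fin using (Fin; zero; suc)
open import Data.Product using (Σ; ∃; ∃₂; _×_; _,_; proj₁; proj₂)
import Data.Product as Product
open import Function using (_∘_; id)
open import Relation.Binary.PropositionalEquality
open import Relation.Nullary using (¬_; Dec; yes; no; ¬?; contradiction)
open import Relation.Unary using (Pred; Decidable; _≐_)
open import Data.Nat.Properties using (≤-refl)

module FiniteCombinatorics where

  open import Data.Nat using (_+_; _*_; _≤_; _<_; _≟_; s≤s)
  open import Data.Nat.Properties
    using (module ≤-Reasoning; +-suc; +-monoˡ-≤; +-cancelˡ-<; <-≤-trans; ≤∧≢⇒<; ≰⇒>; _≤?_; n≮0; ≤-pred)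
  open import Data.List using (List; []; _∷_; length; filter; allFin)
  open import Data.List.Properties using (length-tabulate)
  open import Data.List.Membership.Propositional using (_∈_)
  open import Data.List.Relation.Unary.All as All using (All; _∷_)
  open import Data.List.Relation.Unary.All.Properties as Allₚ using (all-filter; tabulate⁺)
  open import Data.List.Relation.Unary.Any using (here; there)
  open import Data.List.Relation.Unary.AllPairs using (_∷_)
  open import Data.List.Relation.Unary.Unique.Propositional using (Unique)
  import Data.List.Relation.Unary.Unique.Propositional.Properties as Uniqueₚ
  open import Data.List.Relation.Binary.Sublist.Propositional using (_⊆_)
  open import Data.List.Relation.Binary.Sublist.Propositional.Properties
    using (filter⁺; filter-⊆; length-mono-≤)
  open import Relation.Unary.Properties using (∁?)

  length-filter+length-reject : ∀ {a p} {A : Set a} {P : Pred A p} (P? : Decidable P) xs →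
    length (filter P? xs) + length (filter (∁? P?) xs) ≡ length xs
  length-filter+length-reject P? []       = refl
  length-filter+length-reject P? (x ∷ xs) with P? x
  ... | yes _ = cong suc (length-filter+length-reject P? xs)
  ... | no  _ = trans (+-suc _ _) (cong suc (length-filter+length-reject P? xs))

  module _ {a} {A : Set a} (colour : A → ℕ) where

    colourClass : ℕ → List A → List A
    colourClass c = filter (λ x → colour x ≟ c)

    colourClass-mono : ∀ c {xs ys} → xs ⊆ ys → length (colourClass c xs) ≤ length (colourClass c ys)
    colourClass-mono c = length-mono-≤ ∘ filter⁺ (λ x → colour x ≟ c) (λ x → colour x ≟ c) (λ where refl p → p)

    pigeonhole : ∀ m k xs → All (λ x → colour x < m) xs → m * k < length xs →
                 ∃ λ c → k < length (colourClass c xs)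
    pigeonhole zero    k (x ∷ _) (x<0 ∷ _) _ = contradiction x<0 n≮0
    pigeonhole (suc m) k xs bounded mk<n with suc k ≤? length (colourClass m xs)
    ... | yes k<class = m , k<class
    ... | no  k≮class =
      Product.map₂ (λ k<class → <-≤-trans k<class (colourClass-mono _ (filter-⊆ notM? xs)))
                   (pigeonhole m k others othersBounded mk<others)
      where
      notM? : Decidable (λ x → colour x ≢ m)
      notM? = ∁? (λ x → colour x ≟ m)
      others : List A
      others = filter notM? xs
      othersBounded : All (λ x → colour x < m) others
      othersBounded = All.zipWith (λ (x≤m , x≢m) → ≤∧≢⇒< (≤-pred x≤m) x≢m)
                                  (Allₚ.filter⁺ notM? bounded , all-filter notM? xs)
      mk<others : m * k < length others
      mk<others = +-cancelˡ-< k (m * k) (length others) (<-≤-trans mk<n (begin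
        length xs                                 ≡⟨ length-filter+length-reject (λ x → colour x ≟ m) xs ⟨
        length (colourClass m xs) + length others ≤⟨ +-monoˡ-≤ (length others) (≤-pred (≰⇒> k≮class)) ⟩
        k + length others                         ∎))
        where open ≤-Reasoning

  injection-from-unique : ∀ {a} {A : Set a} k (xs : List A) → Unique xs → k < length xs →
    Σ (Fin (suc k) → A) λ σ → (∀ i j → σ i ≡ σ j → i ≡ j) × (∀ i → σ i ∈ xs)
  injection-from-unique zero    (x ∷ _)  _                _          =
    (λ _ → x) , (λ { zero zero _ → refl }) , (λ _ → here refl)
  injection-from-unique (suc k) (x ∷ xs) (x∉xs ∷ unique) (s≤s k<n)
    with injection-from-unique k xs unique k<n
  ... | σ , σ-injective , σ∈xs = τ , τ-injective , τ∈
    where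
    τ : Fin (suc (suc k)) → _
    τ zero    = x
    τ (suc i) = σ i
    x≢σ : ∀ i → x ≢ σ i
    x≢σ i = All.lookup x∉xs (σ∈xs i)
    τ-injective : ∀ i j → τ i ≡ τ j → i ≡ j
    τ-injective zero    zero    _ = refl
    τ-injective zero    (suc j) e = contradiction e (x≢σ j)
    τ-injective (suc i) zero    e = contradiction (sym e) (x≢σ i)
    τ-injective (suc i) (suc j) e = cong suc (σ-injective i j e)
    τ∈ : ∀ i → τ i ∈ x ∷ xs
    τ∈ zero    = here refl
    τ∈ (suc i) = there (σ∈xs i)

  monochromatic-injection : ∀ {n} m k (colour : Fin n → ℕ) → (∀ i → colour i < m) → m * k < n →
    Σ (Fin (suc k) → Fin n) λ σ →
      (∀ i j → σ i ≡ σ j → i ≡ j) × (∀ i j → colour (σ i) ≡ colour (σ j))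
  monochromatic-injection {n} m k colour colour<m mk<n
    with pigeonhole colour m k (allFin n) (tabulate⁺ colour<m)
                    (subst (m * k <_) (sym (length-tabulate id)) mk<n)
  ... | c , k<class
    with injection-from-unique k (colourClass colour c (allFin n))
                               (Uniqueₚ.filter⁺ (λ i → colour i ≟ c) (Uniqueₚ.allFin⁺ n)) k<class
  ... | σ , σ-injective , σ∈class = σ , σ-injective , λ i j → trans (colour≡c i) (sym (colour≡c j))
    where
    colour≡c : ∀ i → colour (σ i) ≡ c
    colour≡c i = All.lookup (all-filter (λ i → colour i ≟ c) (allFin n)) (σ∈class i)

  first : ∀ {n p} {P : Pred (Fin n) p} → Decidable P → ∃ P → ∃ P
  first {zero}  _  (() , _)
  first {suc n} P? (i , Pi) with P? zero
  first P? (i     , Pi) | yes P0 = zero , P0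
  first P? (zero  , P0) | no ¬P0 = contradiction P0 ¬P0
  first P? (suc i , Pi) | no _   = Product.map suc id (first (P? ∘ suc) (i , Pi))

  first-cong : ∀ {n p q} {P : Pred (Fin n) p} {Q : Pred (Fin n) q} → P ≐ Q →
               (P? : Decidable P) (Q? : Decidable Q) (∃P : ∃ P) (∃Q : ∃ Q) →
               proj₁ (first P? ∃P) ≡ proj₁ (first Q? ∃Q)
  first-cong {zero}  _   _  _  (() , _) _
  first-cong {suc n} P≐Q P? Q? (i , Pi) (j , Qj) with P? zero | Q? zero
  ... | yes _  | yes _  = refl
  ... | yes P0 | no ¬Q0 = contradiction (proj₁ P≐Q P0) ¬Q0
  ... | no ¬P0 | yes Q0 = contradiction (proj₂ P≐Q Q0) ¬P0
  first-cong P≐Q P? Q? (zero  , P0) _            | no ¬P0 | no _   = contradiction P0 ¬P0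
  first-cong P≐Q P? Q? (suc _ , _)  (zero  , Q0) | no _   | no ¬Q0 = contradiction Q0 ¬Q0
  first-cong P≐Q P? Q? (suc i , Pi) (suc j , Qj) | no _   | no _   =
    cong suc (first-cong (proj₁ P≐Q , proj₂ P≐Q) (P? ∘ suc) (Q? ∘ suc) (i , Pi) (j , Qj))

open FiniteCombinatorics

module Residues (m : ℕ) where

  open import Data.Nat using (_+_; _*_; _<_)
  open import Data.Nat.Properties using (+-comm)
  open import Data.Nat.DivMod using (_%_; m%n<n; [m+kn]%n≡m%n; %-distribˡ-+; m%n%n≡m%n)
  open import Data.Nat.Tactic.RingSolver using (solve-∀)
  open ≡-Reasoning

  -- p − q modulo 1 + m, written without truncated subtraction since m ≡ −1.
  residue : ℕ → ℕ → ℕ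
  residue p q = (p + m * q) % suc m

  residue<1+m : ∀ p q → residue p q < suc m
  residue<1+m p q = m%n<n (p + m * q) (suc m)

  residue-cong : ∀ {p q p′ q′} → p + q′ ≡ p′ + q → residue p q ≡ residue p′ q′
  residue-cong {p} {q} {p′} {q′} p+q′≡p′+q = begin
    (p + m * q) % suc m                ≡⟨ [m+kn]%n≡m%n (p + m * q) q′ (suc m) ⟨
    (p + m * q + q′ * suc m) % suc m   ≡⟨ cong (_% suc m) (regroup m p q q′) ⟩
    (p + q′ + m * (q + q′)) % suc m    ≡⟨ cong (λ t → (t + m * (q + q′)) % suc m) p+q′≡p′+q ⟩
    (p′ + q + m * (q + q′)) % suc m    ≡⟨ cong (λ t → (p′ + q + m * t) % suc m) (+-comm q q′) ⟩
    (p′ + q + m * (q′ + q)) % suc m    ≡⟨ cong (_% suc m) (regroup m p′ q′ q) ⟨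
    (p′ + m * q′ + q * suc m) % suc m  ≡⟨ [m+kn]%n≡m%n (p′ + m * q′) q (suc m) ⟩
    (p′ + m * q′) % suc m              ∎
    where
    regroup : ∀ m p q r → p + m * q + r * suc m ≡ p + r + m * (q + r)
    regroup = solve-∀

  residue-shift : ∀ d j k p q → residue (d + j * suc m + p) (k * suc m + q) ≡ (residue p q + d) % suc m
  residue-shift d j k p q = begin
    (d + j * suc m + p + m * (k * suc m + q)) % suc m   ≡⟨ cong (_% suc m) (regroup m d j k p q) ⟩
    (p + m * q + d + (j + m * k) * suc m) % suc m       ≡⟨ [m+kn]%n≡m%n (p + m * q + d) (j + m * k) (suc m) ⟩
    (p + m * q + d) % suc m                             ≡⟨ %-distribˡ-+ (p + m * q) d (suc m) ⟩
    (r + d % suc m) % suc m                             ≡⟨ cong (λ t → (t + d % suc m) % suc m) (m%n%n≡m%n (p + m * q) (suc m)) ⟨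
    (r % suc m + d % suc m) % suc m                     ≡⟨ %-distribˡ-+ r d (suc m) ⟨
    (r + d) % suc m                                     ∎
    where
    r : ℕ
    r = residue p q
    regroup : ∀ m d j k p q → d + j * suc m + p + m * (k * suc m + q) ≡ p + m * q + d + (j + m * k) * suc m
    regroup = solve-∀

module ShiftColouring where

  open import Data.Nat using (_+_; _*_; _≤_; _<_; _≟_; s≤s)
  open import Data.Nat.Properties using (allUpTo?)
  open import Data.Nat.DivMod using (_%_; m%n<n)
  open import Relation.Nullary.Decidable using (from-yes)

  colour : ℕ → ℕ
  colour r = (r % 5 + r % 4 + 2 * (r % 3)) % 5

  colour<5 : ∀ r → colour r < 5
  colour<5 r = m%n<n (r % 5 + r % 4 + 2 * (r % 3)) 5

  ShiftChangesColour : ℕ → Set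
  ShiftChangesColour d = ∀ {r} → r < 60 → colour ((r + d) % 60) ≢ colour r

  shiftChangesColour? : ∀ d → Dec (ShiftChangesColour d)
  shiftChangesColour? d = allUpTo? (λ r → ¬? (colour ((r + d) % 60) ≟ colour r)) 60

  fraction-shift : ∀ k i → 2 ≤ k → k ≤ 5 → 1 ≤ i → i < k →
                   ∃ λ c → k * c ≡ 60 × ShiftChangesColour (i * c)
  fraction-shift 2 1 _ _ _ _ = 30 , refl , from-yes (shiftChangesColour? 30)
  fraction-shift 3 1 _ _ _ _ = 20 , refl , from-yes (shiftChangesColour? 20)
  fraction-shift 3 2 _ _ _ _ = 20 , refl , from-yes (shiftChangesColour? 40)
  fraction-shift 4 1 _ _ _ _ = 15 , refl , from-yes (shiftChangesColour? 15)
  fraction-shift 4 2 _ _ _ _ = 15 , refl , from-yes (shiftChangesColour? 30)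
  fraction-shift 4 3 _ _ _ _ = 15 , refl , from-yes (shiftChangesColour? 45)
  fraction-shift 5 1 _ _ _ _ = 12 , refl , from-yes (shiftChangesColour? 12)
  fraction-shift 5 2 _ _ _ _ = 12 , refl , from-yes (shiftChangesColour? 24)
  fraction-shift 5 3 _ _ _ _ = 12 , refl , from-yes (shiftChangesColour? 36)
  fraction-shift 5 4 _ _ _ _ = 12 , refl , from-yes (shiftChangesColour? 48)
  fraction-shift (suc (suc (suc (suc (suc (suc _)))))) _ _ (s≤s (s≤s (s≤s (s≤s (s≤s ()))))) _ _
  fraction-shift 1 _ (s≤s ()) _ _ _
  fraction-shift _ 0 _ _ () _
  fraction-shift 2 (suc (suc _)) _ _ _ (s≤s (s≤s ()))
  fraction-shift 3 (suc (suc (suc _))) _ _ _ (s≤s (s≤s (s≤s ())))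
  fraction-shift 4 (suc (suc (suc (suc _)))) _ _ _ (s≤s (s≤s (s≤s (s≤s ()))))
  fraction-shift 5 (suc (suc (suc (suc (suc _))))) _ _ _ (s≤s (s≤s (s≤s (s≤s (s≤s ())))))

open ShiftColouring

module OrderedField (R : RealNumbers) where
  open RealNumbers R
  import Data.Nat as ℕ
  import Data.Nat.Properties as ℕ
  open import Data.Nat using (_≤′_; ≤′-refl; ≤′-step)
  open import Data.Integer as ℤ using (-[1+_])
  open import Data.Nat.DivMod using (_%_)
  open import Relation.Binary.Definitions using (tri<; tri≈; tri>)
  open import Relation.Binary.Structures using (IsStrictTotalOrder)
  open import Algebra.Bundles using (CommutativeRing)
  open import Algebra.Structures using (IsCommutativeRing)
  open IsCommutativeRing isCommutativeRing
    using (+-identityˡ; +-identityʳ; -‿inverseʳ; *-identityˡ; *-identityʳ; *-assoc; *-comm; +-assoc; +-comm; distribʳ; zeroˡ)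
  open IsStrictTotalOrder <-isStrictTotalOrder using (compare; irrefl) renaming (trans to <-trans)

  commutativeRing : CommutativeRing 0ℓ 0ℓ
  commutativeRing = record { isCommutativeRing = isCommutativeRing }

  open CommutativeRing commutativeRing using (ring; +-group; +-commutativeSemigroup)
  open import Algebra.Properties.Ring ring using (-1*x≈-x; -‿involutive)
  open ≡-Reasoning

  0<1 : 0r < 1r
  0<1 with compare 0r 1r
  ... | tri< 0<1 _ _ = 0<1
  ... | tri≈ _ 0≡1 _ = contradiction 0≡1 0≢1
  ... | tri> _ _ 1<0 = contradiction (<-trans 0<1′ 1<0) (irrefl refl)
    where
    0<-1 : 0r < - 1r
    0<-1 = subst₂ _<_ (-‿inverseʳ 1r) (+-identityˡ (- 1r)) (+-mono-< (- 1r) 1<0)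
    0<1′ : 0r < 1r
    0<1′ = subst (0r <_) (trans (-1*x≈-x (- 1r)) (-‿involutive 1r)) (*-pos 0<-1 0<-1)

  fromℕ-mono-< : ∀ {m n} → m ℕ.< n → fromℕ m < fromℕ n
  fromℕ-mono-< m<n = mono (ℕ.≤⇒≤′ m<n)
    where
    fromℕ<fromℕ-suc : ∀ n → fromℕ n < fromℕ (suc n)
    fromℕ<fromℕ-suc n = subst (_< 1r + fromℕ n) (+-identityˡ (fromℕ n)) (+-mono-< (fromℕ n) 0<1)
    mono : ∀ {m n} → suc m ≤′ n → fromℕ m < fromℕ n
    mono {m} ≤′-refl       = fromℕ<fromℕ-suc m
    mono (≤′-step {n} m<n) = <-trans (mono m<n) (fromℕ<fromℕ-suc n)

  fromℕ-injective : ∀ {m n} → fromℕ m ≡ fromℕ n → m ≡ n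
  fromℕ-injective {m} {n} e with ℕ.<-cmp m n
  ... | tri< m<n _ _ = contradiction (fromℕ-mono-< m<n) (irrefl e)
  ... | tri≈ _ m≡n _ = m≡n
  ... | tri> _ _ n<m = contradiction (fromℕ-mono-< n<m) (irrefl (sym e))

  fromℕ-suc≢0 : ∀ n → fromℕ (suc n) ≢ 0r
  fromℕ-suc≢0 n e = ℕ.0≢1+n (sym (fromℕ-injective {suc n} {0} e))

  fromℕ-+ : ∀ m n → fromℕ (m ℕ.+ n) ≡ fromℕ m + fromℕ n
  fromℕ-+ zero    n = sym (+-identityˡ (fromℕ n))
  fromℕ-+ (suc m) n = trans (cong (1r +_) (fromℕ-+ m n)) (sym (+-assoc 1r (fromℕ m) (fromℕ n)))

  fromℕ-* : ∀ m n → fromℕ (m ℕ.* n) ≡ fromℕ m * fromℕ n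
  fromℕ-* zero    n = sym (zeroˡ (fromℕ n))
  fromℕ-* (suc m) n = begin
    fromℕ (n ℕ.+ m ℕ.* n)              ≡⟨ fromℕ-+ n (m ℕ.* n) ⟩
    fromℕ n + fromℕ (m ℕ.* n)          ≡⟨ cong₂ _+_ (sym (*-identityˡ (fromℕ n))) (fromℕ-* m n) ⟩
    1r * fromℕ n + fromℕ m * fromℕ n   ≡⟨ distribʳ (fromℕ n) 1r (fromℕ m) ⟨
    (1r + fromℕ m) * fromℕ n           ∎

  ⁻¹-unique : ∀ {x y} → x ≢ 0r → x * y ≡ 1r → x ⁻¹ ≡ y
  ⁻¹-unique {x} {y} x≢0 xy≡1 = begin
    x ⁻¹             ≡⟨ *-identityʳ (x ⁻¹) ⟨
    x ⁻¹ * 1r        ≡⟨ cong (x ⁻¹ *_) xy≡1 ⟨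
    x ⁻¹ * (x * y)   ≡⟨ *-assoc (x ⁻¹) x y ⟨
    (x ⁻¹ * x) * y   ≡⟨ cong (_* y) (trans (*-comm (x ⁻¹) x) (⁻¹-inverse x x≢0)) ⟩
    1r * y           ≡⟨ *-identityˡ y ⟩
    y                ∎

  module Grid (m : ℕ) where
    open Residues m
    open import Algebra.Properties.Group +-group using (∙-cancelˡ; //-rightDividesˡ)
    open import Algebra.Properties.AbelianGroup (CommutativeRing.+-abelianGroup commutativeRing) using (⁻¹-anti-homo‿-)
    open import Algebra.Properties.CommutativeSemigroup +-commutativeSemigroup using (xy∙z≈xz∙y)

    δ : ℝ
    δ = fromℕ (suc m) ⁻¹

    [1+m]δ≡1 : fromℕ (suc m) * δ ≡ 1r
    [1+m]δ≡1 = ⁻¹-inverse (fromℕ (suc m)) (fromℕ-suc≢0 m)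

    ticks : ℕ → ℝ
    ticks k = fromℕ k * δ

    ticks-+ : ∀ j k → ticks (j ℕ.+ k) ≡ ticks j + ticks k
    ticks-+ j k = trans (cong (_* δ) (fromℕ-+ j k)) (distribʳ δ (fromℕ j) (fromℕ k))

    ticks[k*[1+m]]≡k : ∀ k → ticks (k ℕ.* suc m) ≡ fromℕ k
    ticks[k*[1+m]]≡k k = begin
      fromℕ (k ℕ.* suc m) * δ        ≡⟨ cong (_* δ) (fromℕ-* k (suc m)) ⟩
      fromℕ k * fromℕ (suc m) * δ    ≡⟨ *-assoc (fromℕ k) (fromℕ (suc m)) δ ⟩
      fromℕ k * (fromℕ (suc m) * δ)  ≡⟨ cong (fromℕ k *_) [1+m]δ≡1 ⟩
      fromℕ k * 1r                   ≡⟨ *-identityʳ (fromℕ k) ⟩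
      fromℕ k                        ∎

    ticks[k]*[1+m]≡k : ∀ k → ticks k * fromℕ (suc m) ≡ fromℕ k
    ticks[k]*[1+m]≡k k = begin
      fromℕ k * δ * fromℕ (suc m)    ≡⟨ *-assoc (fromℕ k) δ (fromℕ (suc m)) ⟩
      fromℕ k * (δ * fromℕ (suc m))  ≡⟨ cong (fromℕ k *_) (trans (*-comm δ (fromℕ (suc m))) [1+m]δ≡1) ⟩
      fromℕ k * 1r                   ≡⟨ *-identityʳ (fromℕ k) ⟩
      fromℕ k                        ∎

    ticks-injective : ∀ {j k} → ticks j ≡ ticks k → j ≡ k
    ticks-injective {j} {k} e =
      fromℕ-injective (trans (sym (ticks[k]*[1+m]≡k j)) (trans (cong (_* fromℕ (suc m)) e) (ticks[k]*[1+m]≡k k)))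

    frac≡ticks : ∀ i {k c} → k ℕ.* c ≡ suc m → frac i k ≡ ticks (i ℕ.* c)
    frac≡ticks i {k} {c} kc≡1+m = begin
      fromℕ i * fromℕ k ⁻¹       ≡⟨ cong (fromℕ i *_) (⁻¹-unique k≢0 k*cδ≡1) ⟩
      fromℕ i * (fromℕ c * δ)    ≡⟨ *-assoc (fromℕ i) (fromℕ c) δ ⟨
      fromℕ i * fromℕ c * δ      ≡⟨ cong (_* δ) (fromℕ-* i c) ⟨
      ticks (i ℕ.* c)            ∎
      where
      k≢0 : fromℕ k ≢ 0r
      k≢0 e = ℕ.0≢1+n (trans (cong (ℕ._* c) (sym (fromℕ-injective {k} {0} e))) kc≡1+m)
      k*cδ≡1 : fromℕ k * (fromℕ c * δ) ≡ 1r
      k*cδ≡1 = begin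
        fromℕ k * (fromℕ c * δ)  ≡⟨ *-assoc (fromℕ k) (fromℕ c) δ ⟨
        fromℕ k * fromℕ c * δ    ≡⟨ cong (_* δ) (trans (sym (fromℕ-* k c)) (cong fromℕ kc≡1+m)) ⟩
        fromℕ (suc m) * δ        ≡⟨ [1+m]δ≡1 ⟩
        1r                       ∎

    -- x − y = (p − q)/(1 + m), written without subtraction.
    record Gap (x y : ℝ) (p q : ℕ) : Set where
      constructor gap
      field balance : x + ticks q ≡ y + ticks p

    Gap-sym : ∀ {x y p q} → Gap x y p q → Gap y x q p
    Gap-sym (gap e) = gap (sym e)

    Gap-trans : ∀ {x y z p q p′ q′} → Gap x y p q → Gap y z p′ q′ → Gap x z (p ℕ.+ p′) (q ℕ.+ q′)
    Gap-trans {x} {y} {z} {p} {q} {p′} {q′} (gap x~y) (gap y~z) = gap (begin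
      x + ticks (q ℕ.+ q′)          ≡⟨ cong (x +_) (ticks-+ q q′) ⟩
      x + (ticks q + ticks q′)      ≡⟨ +-assoc x (ticks q) (ticks q′) ⟨
      x + ticks q + ticks q′        ≡⟨ cong (_+ ticks q′) x~y ⟩
      y + ticks p + ticks q′        ≡⟨ xy∙z≈xz∙y y (ticks p) (ticks q′) ⟩
      y + ticks q′ + ticks p        ≡⟨ cong (_+ ticks p) y~z ⟩
      z + ticks p′ + ticks p        ≡⟨ xy∙z≈xz∙y z (ticks p′) (ticks p) ⟩
      z + ticks p + ticks p′        ≡⟨ +-assoc z (ticks p) (ticks p′) ⟩
      z + (ticks p + ticks p′)      ≡⟨ cong (z +_) (ticks-+ p p′) ⟨
      z + ticks (p ℕ.+ p′)          ∎)

    Gap-unique : ∀ {x y p q p′ q′} → Gap x y p q → Gap x y p′ q′ → p ℕ.+ q′ ≡ p′ ℕ.+ q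
    Gap-unique {x} {q = q} {p′} x~y x~y′ with Gap-trans x~y (Gap-sym x~y′)
    ... | gap x~x = trans (ticks-injective (sym (∙-cancelˡ x _ _ x~x))) (ℕ.+-comm q p′)

    Gap-shift : ∀ {x y d p q} → Gap (x + ticks d) y p q → Gap x y p (d ℕ.+ q)
    Gap-shift {x} {y} {d} {p} {q} (gap e) = gap (begin
      x + ticks (d ℕ.+ q)       ≡⟨ cong (x +_) (ticks-+ d q) ⟩
      x + (ticks d + ticks q)   ≡⟨ +-assoc x (ticks d) (ticks q) ⟨
      x + ticks d + ticks q     ≡⟨ e ⟩
      y + ticks p               ∎)

    difference-natural : ∀ {x y} n → x - y ≡ fromℕ n → Gap x y (n ℕ.* suc m) 0
    difference-natural {x} {y} n e = gap (begin
      x + ticks 0               ≡⟨ cong (x +_) (zeroˡ δ) ⟩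
      x + 0r                    ≡⟨ +-identityʳ x ⟩
      x                         ≡⟨ //-rightDividesˡ y x ⟨
      x - y + y                 ≡⟨ cong (_+ y) e ⟩
      fromℕ n + y               ≡⟨ +-comm (fromℕ n) y ⟩
      y + fromℕ n               ≡⟨ cong (y +_) (ticks[k*[1+m]]≡k n) ⟨
      y + ticks (n ℕ.* suc m)   ∎)

    ≈₁⇒Gap : ∀ {x y} → x ≈₁ y → ∃₂ λ j k → Gap x y (j ℕ.* suc m) (k ℕ.* suc m)
    ≈₁⇒Gap (ℤ.+ n , e) = n , 0 , difference-natural n e
    ≈₁⇒Gap {x} {y} (-[1+ n ] , e) = 0 , suc n , Gap-sym (difference-natural (suc n) y-x≡1+n)
      where
      y-x≡1+n : y - x ≡ fromℕ (suc n)
      y-x≡1+n = trans (sym (⁻¹-anti-homo‿- x y)) (trans (cong -_ e) (-‿involutive _))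

    module Classes (lem : ExcludedMiddle 0ℓ) {n} (f : Fin n → ℝ) where

      SameClass : Fin n → Fin n → Set
      SameClass a b = ∃₂ λ p q → Gap (f a) (f b) p q

      firstInClass : ∀ a → ∃ (SameClass a)
      firstInClass a = first {P = SameClass a} (λ _ → lem) (a , 0 , 0 , gap refl)

      representative : Fin n → Fin n
      representative = proj₁ ∘ firstInClass

      inClass-representative : ∀ a → SameClass a (representative a)
      inClass-representative = proj₂ ∘ firstInClass

      representative-cong : ∀ {a b} → SameClass a b → representative a ≡ representative b
      representative-cong (_ , _ , a~b) = first-cong
        ((λ (_ , _ , a~c) → _ , _ , Gap-trans (Gap-sym a~b) a~c) , (λ (_ , _ , b~c) → _ , _ , Gap-trans a~b b~c))
        (λ _ → lem) (λ _ → lem) _ _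

      residueOf : ∀ {a c} → SameClass a c → ℕ
      residueOf (p , q , _) = residue p q

      residueOf-unique : ∀ {a c} (w w′ : SameClass a c) → residueOf w ≡ residueOf w′
      residueOf-unique (p , q , a~c) (p′ , q′ , a~c′) = residue-cong {p} {q} {p′} {q′} (Gap-unique a~c a~c′)

      residueOf<1+m : ∀ {a c} (w : SameClass a c) → residueOf w ℕ.< suc m
      residueOf<1+m (p , q , _) = residue<1+m p q

      position : Fin n → ℕ
      position a = residueOf (inClass-representative a)

      position<1+m : ∀ a → position a ℕ.< suc m
      position<1+m a = residueOf<1+m (inClass-representative a)

      position-shift : ∀ {a b d j k} → Gap (f b) (f a) (d ℕ.+ j ℕ.* suc m) (k ℕ.* suc m) →
                       position b ≡ (position a ℕ.+ d) % suc m
      position-shift {a} {b} {d} {j} {k} b~a = shifted (inClass-representative a)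
        where
        shifted : (w : SameClass a (representative a)) → position b ≡ (residueOf w ℕ.+ d) % suc m
        shifted (p , q , a~rep) = begin
          position b                                            ≡⟨ residueOf-unique (inClass-representative b) (_ , _ , b~rep) ⟩
          residue (d ℕ.+ j ℕ.* suc m ℕ.+ p) (k ℕ.* suc m ℕ.+ q) ≡⟨ residue-shift d j k p q ⟩
          (residue p q ℕ.+ d) % suc m                           ∎
          where
          b~rep : Gap (f b) (f (representative b)) (d ℕ.+ j ℕ.* suc m ℕ.+ p) (k ℕ.* suc m ℕ.+ q)
          b~rep = subst (λ c → Gap (f b) (f c) _ _) (sym (representative-cong (_ , _ , b~a)))
                        (Gap-trans b~a a~rep)

  module Colouring (lem : ExcludedMiddle 0ℓ) {n} (f : Fin n → ℝ) where
    open Grid 59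
    open Classes lem f public

    colouring-proper : ∀ {a b} k i → 2 ℕ.≤ k → k ℕ.≤ 5 → 1 ℕ.≤ i → i ℕ.< k →
                       colour (position a) ≡ colour (position b) → ¬ (f a + frac i k ≈₁ f b)
    colouring-proper {a} {b} k i 2≤k k≤5 1≤i i<k same a+i/k≈b
      with fraction-shift k i 2≤k k≤5 1≤i i<k | ≈₁⇒Gap a+i/k≈b
    ... | c , k*c≡60 , shift-changes | j , l , a+i/k~b =
      shift-changes (position<1+m a)
                    (trans (cong colour (sym (position-shift {j = l} {k = j} b~a))) (sym same))
      where
      b~a : Gap (f b) (f a) (i ℕ.* c ℕ.+ l ℕ.* 60) (j ℕ.* 60)
      b~a = Gap-sym (Gap-shift (subst (λ t → Gap (f a + t) (f b) _ _) (frac≡ticks i {k} k*c≡60) a+i/k~b))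

mainTheorem9 : ExcludedMiddle 0ℓ → (R : RealNumbers) → Theorem9 R
mainTheorem9 lem R W _ (f , f∈W , f-distinct) =
  let σ , σ-injective , σ-monochromatic =
        monochromatic-injection 5 3 (colour ∘ position) (colour<5 ∘ position) ≤-refl
  in f ∘ σ , f∈W ∘ σ , (λ a b → σ-injective a b ∘ f-distinct (σ a) (σ b)) ,
     λ k i 2≤k k≤5 1≤i i<k a b → colouring-proper k i 2≤k k≤5 1≤i i<k (σ-monochromatic a b)
  where
  open OrderedField R
  open Colouring lem f
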